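{- If the field $\mathbb K$ is of positive characteristic $p$, then the special shuffle-group $(1+X\mathbb K[[X]],\sqcup\!\sqcup)$ is isomorphic to an infinite-dimensional $\mathbb F_p$-vector space.
   Context: The shuffle product on $\mathbb K[[X]]$ is defined by $\left(\sum_{n\ge0}\alpha_nX^n\right)\sqcup\!\sqcup\left(\sum_{n\ge0}\beta_nX^n\right)=\sum_{n\ge0}\gamma_nX^n$ with $\gamma_n=\sum_{k=0}^n\binom{n}{k}\alpha_k\beta_{n-k}$. The special shuffle-group is the set $1+X\mathbb K[[X]]$ of power series with constant term $1$, with group law given by the shuffle product. -}

module Defs where

open import Level using (Level; _⊔_) renaming (suc to lsuc)
open import Algebra.Bundles using (CommutativeRing)
open import Algebra.Structures using (IsAbelianGroup)
open import Data.Nat using (ℕ; zero; suc; _∸_; _<_)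
open import Data.Nat.Combinatorics using (_C_)
open import Data.Fin using (Fin; toℕ)
import Data.Fin as Fin
open import Data.Product using (Σ; ∃; _×_; _,_; proj₁)
open import Relation.Nullary using (¬_)
open import Relation.Binary.PropositionalEquality using (_≡_)

record Field (c ℓ : Level) : Set (lsuc (c ⊔ ℓ)) where
  field
    commutativeRing : CommutativeRing c ℓ
  open CommutativeRing commutativeRing public
  field
    1≉0     : ¬ (1# ≈ 0#)
    inverse : ∀ x → ¬ (x ≈ 0#) → ∃ λ y → (x * y) ≈ 1#

module FieldOps {c ℓ : Level} (K : Field c ℓ) where
  open Field K
  open import Algebra.Definitions.RawMonoid +-rawMonoid public
    using () renaming (_×_ to _·_)

  HasCharacteristic : ℕ → Set ℓ
  HasCharacteristic p =
    (0 < p) × ((p · 1#) ≈ 0#) × (∀ m → 0 < m → m < p → ¬ ((m · 1#) ≈ 0#))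

module Shuffle {c ℓ : Level} (K : Field c ℓ) where
  open Field K
  open FieldOps K

  Series : Set c
  Series = ℕ → Carrier

  _≈ₛ_ : Series → Series → Set ℓ
  f ≈ₛ g = ∀ n → f n ≈ g n

  sumTo : ℕ → (ℕ → Carrier) → Carrier
  sumTo zero    h = h 0
  sumTo (suc n) h = sumTo n h + h (suc n)

  _⧢_ : Series → Series → Series
  (f ⧢ g) n = sumTo n (λ k → (n C k) · (f k * g (n ∸ k)))

  Special : Set (c ⊔ ℓ)
  Special = Σ Series (λ f → f 0 ≈ 1#)

  _≈ᵍ_ : Special → Special → Set ℓ
  f ≈ᵍ g = proj₁ f ≈ₛ proj₁ g

  private
    const0 : ∀ (f g : Special) → (proj₁ f ⧢ proj₁ g) 0 ≈ 1#
    const0 (f , f0) (g , g0) = begin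
        (1 · (f 0 * g 0))   ≈⟨ +-identityʳ (f 0 * g 0) ⟩
        f 0 * g 0           ≈⟨ *-cong f0 g0 ⟩
        1# * 1#             ≈⟨ *-identityˡ 1# ⟩
        1# ∎
      where open import Relation.Binary.Reasoning.Setoid setoid

  _⧢ᵍ_ : Special → Special → Special
  f ⧢ᵍ g = (proj₁ f ⧢ proj₁ g) , const0 f g

  𝟙 : Special
  𝟙 = (λ { zero → 1# ; (suc _) → 0# }) , refl

  _^ᵍ_ : Special → ℕ → Special
  f ^ᵍ zero  = 𝟙
  f ^ᵍ suc n = f ⧢ᵍ (f ^ᵍ n)

  -- Π_{i<n} (v i)^{a i}, the F_p-linear combination Σ aᵢ vᵢ written multiplicatively
  linComb : ∀ {n} → (Fin n → ℕ) → (Fin n → Special) → Special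
  linComb {zero}  a v = 𝟙
  linComb {suc n} a v = (v Fin.zero ^ᵍ a Fin.zero) ⧢ᵍ linComb (λ i → a (Fin.suc i)) (λ i → v (Fin.suc i))

  LinearlyIndependent : (p : ℕ) → ∀ {n} → (Fin n → Special) → Set ℓ
  LinearlyIndependent p {n} v =
    ∀ (a : Fin n → Fin p) → linComb (λ i → toℕ (a i)) v ≈ᵍ 𝟙 → ∀ i → toℕ (a i) ≡ 0

{-# OPTIONS --safe #-}
-- Write ∂ for the shift f ↦ Σ αₙ₊₁ Xⁿ. By Pascal's rule ∂ is a derivation of the shuffle
-- product, and commutativity, associativity and the unit laws follow from this by induction
-- on the degree.
-- The derivation rule gives ∂(f^{⧢ p}) = p · (∂f ⧢ f^{⧢ (p-1)}), which vanishes in characteristic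
-- p, so f^{⧢ p} = 1: the group is an 𝔽ₚ-vector space with inverse f^{⧢ (p-1)}. For independence,
-- the product of series 1 + cXᵈ + O(Xᵈ⁺¹) and 1 + c′Xᵈ + O(Xᵈ⁺¹) is 1 + (c + c′)Xᵈ + O(Xᵈ⁺¹);
-- hence in Π (1 + Xᵉ⁺ⁱ)^{aᵢ} the coefficient of Xᵉ is a₀ · 1, which forces a₀ = 0 when the
-- product is 1, and induction on the number of factors does the rest.
module Submission where

open import Defs
open import Level using (Level)
open import Function using (_∘_)
open import Data.Nat as ℕ using (ℕ; zero; suc; _∸_; _<_; _≤_; z≤n; s≤s)
import Data.Nat.Properties as ℕₚ
open import Data.Nat.Combinatorics using (_C_; k>n⇒nCk≡0; nCk+nC[k+1]≡[n+1]C[k+1])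
open import Data.Fin as Fin using (Fin; toℕ)
open import Data.Fin.Properties using (toℕ<n)
open import Data.Product using (Σ; ∃; _×_; _,_; proj₁; proj₂)
open import Data.Sum using (_⊎_; inj₁; inj₂)
open import Data.Empty using (⊥-elim)
open import Algebra.Structures using (IsAbelianGroup)
open import Relation.Nullary using (¬_; yes; no)
open import Relation.Binary.PropositionalEquality as ≡ using (_≡_)

<-+-split : ∀ a b {n k} → k ≤ n → n < a ℕ.+ b → k < a ⊎ n ∸ k < b
<-+-split a b {n} {k} k≤n n<a+b with n ∸ k ℕ.<? b
... | yes n∸k<b = inj₂ n∸k<b
... | no  n∸k≮b = inj₁ (ℕₚ.+-cancelʳ-< b k a (begin-strict
      k ℕ.+ b        ≤⟨ ℕₚ.+-monoʳ-≤ k (ℕₚ.≮⇒≥ n∸k≮b) ⟩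
      k ℕ.+ (n ∸ k)  ≡⟨ ℕₚ.m+[n∸m]≡n k≤n ⟩
      n              <⟨ n<a+b ⟩
      a ℕ.+ b        ∎))
  where open ℕₚ.≤-Reasoning

module ShuffleAlgebra {c ℓ : Level} (K : Field c ℓ) where
  open Field K hiding (zero)
  open FieldOps K
  open Shuffle K
  open import Relation.Binary.Reasoning.Setoid setoid
  open import Algebra.Properties.CommutativeSemigroup +-commutativeSemigroup using (interchange)
  open import Algebra.Properties.Monoid.Mult +-monoid using (×-homo-+; ×-congʳ; ×-cong)
  open import Algebra.Properties.CommutativeMonoid.Mult +-commutativeMonoid using (×-distrib-+)
  open import Algebra.Properties.Semiring.Mult semiring using (×-assoc-*)

  ·≈·1#* : ∀ m x → m · x ≈ (m · 1#) * x
  ·≈·1#* m x = trans (×-congʳ m (sym (*-identityˡ x))) (sym (×-assoc-* m 1# x))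

  ·-zeroʳ : ∀ m → m · 0# ≈ 0#
  ·-zeroʳ m = trans (·≈·1#* m 0#) (zeroʳ (m · 1#))

  sumTo-cong : ∀ n {h h′ : ℕ → Carrier} → (∀ k → k ≤ n → h k ≈ h′ k) → sumTo n h ≈ sumTo n h′
  sumTo-cong zero    h≈h′ = h≈h′ 0 z≤n
  sumTo-cong (suc n) h≈h′ =
    +-cong (sumTo-cong n (λ k k≤n → h≈h′ k (ℕₚ.m≤n⇒m≤1+n k≤n))) (h≈h′ (suc n) ℕₚ.≤-refl)

  sumTo-zero : ∀ n {h : ℕ → Carrier} → (∀ k → k ≤ n → h k ≈ 0#) → sumTo n h ≈ 0#
  sumTo-zero zero    h≈0 = h≈0 0 z≤n
  sumTo-zero (suc n) h≈0 =
    trans (+-cong (sumTo-zero n (λ k k≤n → h≈0 k (ℕₚ.m≤n⇒m≤1+n k≤n))) (h≈0 (suc n) ℕₚ.≤-refl))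
          (+-identityʳ 0#)

  sumTo-distrib-+ : ∀ n (h h′ : ℕ → Carrier) → sumTo n (λ k → h k + h′ k) ≈ sumTo n h + sumTo n h′
  sumTo-distrib-+ zero    h h′ = refl
  sumTo-distrib-+ (suc n) h h′ = trans (+-congʳ (sumTo-distrib-+ n h h′)) (interchange _ _ _ _)

  sumTo-unfoldˡ : ∀ n (h : ℕ → Carrier) → sumTo (suc n) h ≈ h 0 + sumTo n (h ∘ suc)
  sumTo-unfoldˡ zero    h = refl
  sumTo-unfoldˡ (suc n) h = trans (+-congʳ (sumTo-unfoldˡ n h)) (+-assoc _ _ _)

  ∂ : Series → Series
  ∂ f n = f (suc n)

  infixl 6 _⊕_
  _⊕_ : Series → Series → Series
  (f ⊕ g) n = f n + g n

  _·ₛ_ : ℕ → Series → Series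
  (m ·ₛ f) n = m · f n

  𝟘 : Series
  𝟘 _ = 0#

  𝟙ₛ : Series
  𝟙ₛ = proj₁ 𝟙

  ⧢-head : ∀ f g → (f ⧢ g) 0 ≈ f 0 * g 0
  ⧢-head f g = +-identityʳ (f 0 * g 0)

  ⧢-cong : ∀ n {f f′ g g′} → f ≈ₛ f′ → g ≈ₛ g′ → (f ⧢ g) n ≈ (f′ ⧢ g′) n
  ⧢-cong n f≈f′ g≈g′ = sumTo-cong n (λ k _ → ×-congʳ (n C k) (*-cong (f≈f′ k) (g≈g′ (n ∸ k))))

  ⧢-congˡ : ∀ n f {g g′} → g ≈ₛ g′ → (f ⧢ g) n ≈ (f ⧢ g′) n
  ⧢-congˡ n f = ⧢-cong n {f} {f} (λ _ → refl)

  ⧢-congʳ : ∀ n g {f f′} → f ≈ₛ f′ → (f ⧢ g) n ≈ (f′ ⧢ g) n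
  ⧢-congʳ n g f≈f′ = ⧢-cong n {g = g} {g′ = g} f≈f′ (λ _ → refl)

  ⧢-zeroˡ : ∀ n g → (𝟘 ⧢ g) n ≈ 0#
  ⧢-zeroˡ n g = sumTo-zero n (λ k _ → trans (×-congʳ (n C k) (zeroˡ _)) (·-zeroʳ (n C k)))

  ⧢-distribʳ : ∀ n f g h → ((f ⊕ g) ⧢ h) n ≈ (f ⧢ h) n + (g ⧢ h) n
  ⧢-distribʳ n f g h = trans
    (sumTo-cong n (λ k _ → trans (×-congʳ (n C k) (distribʳ _ _ _)) (×-distrib-+ _ _ (n C k))))
    (sumTo-distrib-+ n _ _)

  ⧢-∂ʳ-unfold : ∀ f g n →
    (f ⧢ ∂ g) n ≈ 1 · (f 0 * g (suc n)) + sumTo n (λ k → (n C suc k) · (f (suc k) * g (n ∸ k)))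
  ⧢-∂ʳ-unfold f g zero    = sym (+-identityʳ _)
  ⧢-∂ʳ-unfold f g (suc m) = begin
    (f ⧢ ∂ g) (suc m)                                   ≈⟨ sumTo-unfoldˡ m _ ⟩
    1 · (f 0 * g (suc (suc m))) + sumTo m term           ≈⟨ +-congˡ (sumTo-cong m shift-index) ⟨
    1 · (f 0 * g (suc (suc m))) + sumTo m term′          ≈⟨ +-congˡ (+-identityʳ _) ⟨
    1 · (f 0 * g (suc (suc m))) + (sumTo m term′ + 0#)   ≈⟨ +-congˡ (+-congˡ last≈0) ⟨
    1 · (f 0 * g (suc (suc m))) + sumTo (suc m) term′    ∎
    where
      term term′ : ℕ → Carrier
      term  k = (suc m C suc k) · (f (suc k) * g (suc (m ∸ k)))
      term′ k = (suc m C suc k) · (f (suc k) * g (suc m ∸ k))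
      shift-index : ∀ k → k ≤ m → term′ k ≈ term k
      shift-index k k≤m =
        ×-congʳ (suc m C suc k) (*-congˡ (reflexive (≡.cong g (ℕₚ.+-∸-assoc 1 k≤m))))
      last≈0 : term′ (suc m) ≈ 0#
      last≈0 = ×-cong (k>n⇒nCk≡0 (ℕₚ.n<1+n (suc m))) refl

  -- Pascal's rule C(n+1,k+1) = C(n,k) + C(n,k+1) splits the coefficients of (f ⧢ g)ₙ₊₁.
  ∂-leibniz : ∀ f g n → ∂ (f ⧢ g) n ≈ (∂ f ⧢ g) n + (f ⧢ ∂ g) n
  ∂-leibniz f g n = begin
    (f ⧢ g) (suc n)
      ≈⟨ sumTo-unfoldˡ n _ ⟩
    first + sumTo n (λ k → (suc n C suc k) · (f (suc k) * g (n ∸ k)))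
      ≈⟨ +-congˡ (sumTo-cong n pascal) ⟩
    first + sumTo n (λ k → left k + right k)
      ≈⟨ +-congˡ (sumTo-distrib-+ n left right) ⟩
    first + ((∂ f ⧢ g) n + sumTo n right)
      ≈⟨ +-assoc _ _ _ ⟨
    first + (∂ f ⧢ g) n + sumTo n right
      ≈⟨ +-congʳ (+-comm _ _) ⟩
    (∂ f ⧢ g) n + first + sumTo n right
      ≈⟨ +-assoc _ _ _ ⟩
    (∂ f ⧢ g) n + (first + sumTo n right)
      ≈⟨ +-congˡ (⧢-∂ʳ-unfold f g n) ⟨
    (∂ f ⧢ g) n + (f ⧢ ∂ g) n ∎
    where
      first : Carrier
      first = 1 · (f 0 * g (suc n))
      left right : ℕ → Carrier
      left  k = (n C k) · (f (suc k) * g (n ∸ k))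
      right k = (n C suc k) · (f (suc k) * g (n ∸ k))
      pascal : ∀ k → k ≤ n → (suc n C suc k) · (f (suc k) * g (n ∸ k)) ≈ left k + right k
      pascal k _ = trans (×-cong (≡.sym (nCk+nC[k+1]≡[n+1]C[k+1] n k)) refl)
                         (×-homo-+ _ (n C k) (n C suc k))

  ⧢-comm : ∀ n f g → (f ⧢ g) n ≈ (g ⧢ f) n
  ⧢-comm zero    f g = trans (⧢-head f g) (trans (*-comm _ _) (sym (⧢-head g f)))
  ⧢-comm (suc n) f g = begin
    (f ⧢ g) (suc n)                  ≈⟨ ∂-leibniz f g n ⟩
    (∂ f ⧢ g) n + (f ⧢ ∂ g) n        ≈⟨ +-cong (⧢-comm n (∂ f) g) (⧢-comm n f (∂ g)) ⟩
    (g ⧢ ∂ f) n + (∂ g ⧢ f) n        ≈⟨ +-comm _ _ ⟩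
    (∂ g ⧢ f) n + (g ⧢ ∂ f) n        ≈⟨ ∂-leibniz g f n ⟨
    (g ⧢ f) (suc n)                  ∎

  ⧢-zeroʳ : ∀ n f → (f ⧢ 𝟘) n ≈ 0#
  ⧢-zeroʳ n f = trans (⧢-comm n f 𝟘) (⧢-zeroˡ n f)

  ⧢-distribˡ : ∀ n f g h → (f ⧢ (g ⊕ h)) n ≈ (f ⧢ g) n + (f ⧢ h) n
  ⧢-distribˡ n f g h =
    trans (⧢-comm n f (g ⊕ h)) (trans (⧢-distribʳ n g h f) (+-cong (⧢-comm n g f) (⧢-comm n h f)))

  ⧢-·ₛʳ : ∀ m n f g → (f ⧢ (m ·ₛ g)) n ≈ m · (f ⧢ g) n
  ⧢-·ₛʳ zero    n f g = ⧢-zeroʳ n f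
  ⧢-·ₛʳ (suc m) n f g = trans (⧢-distribˡ n f g (m ·ₛ g)) (+-congˡ (⧢-·ₛʳ m n f g))

  ⧢-identityˡ : ∀ n f → (𝟙ₛ ⧢ f) n ≈ f n
  ⧢-identityˡ zero    f = trans (⧢-head 𝟙ₛ f) (*-identityˡ _)
  ⧢-identityˡ (suc n) f = trans (∂-leibniz 𝟙ₛ f n)
    (trans (+-cong (⧢-zeroˡ n f) (⧢-identityˡ n (∂ f))) (+-identityˡ _))

  ⧢-identityʳ : ∀ n f → (f ⧢ 𝟙ₛ) n ≈ f n
  ⧢-identityʳ n f = trans (⧢-comm n f 𝟙ₛ) (⧢-identityˡ n f)

  ⧢-assoc : ∀ n f g h → ((f ⧢ g) ⧢ h) n ≈ (f ⧢ (g ⧢ h)) n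
  ⧢-assoc zero    f g h = begin
    ((f ⧢ g) ⧢ h) 0      ≈⟨ trans (⧢-head (f ⧢ g) h) (*-congʳ (⧢-head f g)) ⟩
    (f 0 * g 0) * h 0    ≈⟨ *-assoc _ _ _ ⟩
    f 0 * (g 0 * h 0)    ≈⟨ trans (⧢-head f (g ⧢ h)) (*-congˡ (⧢-head g h)) ⟨
    (f ⧢ (g ⧢ h)) 0      ∎
  ⧢-assoc (suc n) f g h = begin
    ((f ⧢ g) ⧢ h) (suc n)
      ≈⟨ ∂-leibniz (f ⧢ g) h n ⟩
    (∂ (f ⧢ g) ⧢ h) n + ((f ⧢ g) ⧢ ∂ h) n
      ≈⟨ +-congʳ (⧢-congʳ n h (∂-leibniz f g)) ⟩
    (((∂ f ⧢ g) ⊕ (f ⧢ ∂ g)) ⧢ h) n + ((f ⧢ g) ⧢ ∂ h) n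
      ≈⟨ +-congʳ (⧢-distribʳ n (∂ f ⧢ g) (f ⧢ ∂ g) h) ⟩
    ((∂ f ⧢ g) ⧢ h) n + ((f ⧢ ∂ g) ⧢ h) n + ((f ⧢ g) ⧢ ∂ h) n
      ≈⟨ +-cong (+-cong (⧢-assoc n (∂ f) g h) (⧢-assoc n f (∂ g) h)) (⧢-assoc n f g (∂ h)) ⟩
    (∂ f ⧢ (g ⧢ h)) n + (f ⧢ (∂ g ⧢ h)) n + (f ⧢ (g ⧢ ∂ h)) n
      ≈⟨ +-assoc _ _ _ ⟩
    (∂ f ⧢ (g ⧢ h)) n + ((f ⧢ (∂ g ⧢ h)) n + (f ⧢ (g ⧢ ∂ h)) n)
      ≈⟨ +-congˡ (⧢-distribˡ n f (∂ g ⧢ h) (g ⧢ ∂ h)) ⟨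
    (∂ f ⧢ (g ⧢ h)) n + (f ⧢ ((∂ g ⧢ h) ⊕ (g ⧢ ∂ h))) n
      ≈⟨ +-congˡ (⧢-congˡ n f (λ k → sym (∂-leibniz g h k))) ⟩
    (∂ f ⧢ (g ⧢ h)) n + (f ⧢ ∂ (g ⧢ h)) n
      ≈⟨ ∂-leibniz f (g ⧢ h) n ⟨
    (f ⧢ (g ⧢ h)) (suc n) ∎

  ∂-^ᵍ : ∀ k f n → ∂ (proj₁ (f ^ᵍ suc k)) n ≈ suc k · (∂ (proj₁ f) ⧢ proj₁ (f ^ᵍ k)) n
  ∂-^ᵍ zero    (f , _) n = trans (∂-leibniz f 𝟙ₛ n) (+-congˡ (⧢-zeroʳ n f))
  ∂-^ᵍ (suc k) F@(f , _) n = begin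
    ∂ (f ⧢ fᵏ⁺¹) n                          ≈⟨ ∂-leibniz f fᵏ⁺¹ n ⟩
    (∂ f ⧢ fᵏ⁺¹) n + (f ⧢ ∂ fᵏ⁺¹) n         ≈⟨ +-congˡ (⧢-congˡ n f (∂-^ᵍ k F)) ⟩
    (∂ f ⧢ fᵏ⁺¹) n + (f ⧢ (suc k ·ₛ (∂ f ⧢ fᵏ))) n
                                             ≈⟨ +-congˡ (⧢-·ₛʳ (suc k) n f (∂ f ⧢ fᵏ)) ⟩
    (∂ f ⧢ fᵏ⁺¹) n + suc k · (f ⧢ (∂ f ⧢ fᵏ)) n
                                             ≈⟨ +-congˡ (×-congʳ (suc k) exchange) ⟩
    (∂ f ⧢ fᵏ⁺¹) n + suc k · (∂ f ⧢ fᵏ⁺¹) n ∎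
    where
      fᵏ fᵏ⁺¹ : Series
      fᵏ   = proj₁ (F ^ᵍ k)
      fᵏ⁺¹ = proj₁ (F ^ᵍ suc k)
      exchange : (f ⧢ (∂ f ⧢ fᵏ)) n ≈ (∂ f ⧢ fᵏ⁺¹) n
      exchange = begin
        (f ⧢ (∂ f ⧢ fᵏ)) n    ≈⟨ ⧢-assoc n f (∂ f) fᵏ ⟨
        ((f ⧢ ∂ f) ⧢ fᵏ) n    ≈⟨ ⧢-congʳ n fᵏ (λ m → ⧢-comm m f (∂ f)) ⟩
        ((∂ f ⧢ f) ⧢ fᵏ) n    ≈⟨ ⧢-assoc n (∂ f) f fᵏ ⟩
        (∂ f ⧢ fᵏ⁺¹) n        ∎

  ^ᵍ-characteristic : ∀ k → (suc k · 1#) ≈ 0# → ∀ f → (f ^ᵍ suc k) ≈ᵍ 𝟙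
  ^ᵍ-characteristic k p·1≈0 f zero    = proj₂ (f ^ᵍ suc k)
  ^ᵍ-characteristic k p·1≈0 f (suc n) = begin
    ∂ (proj₁ (f ^ᵍ suc k)) n            ≈⟨ ∂-^ᵍ k f n ⟩
    suc k · x                           ≈⟨ ·≈·1#* (suc k) x ⟩
    (suc k · 1#) * x                    ≈⟨ *-congʳ p·1≈0 ⟩
    0# * x                              ≈⟨ zeroˡ x ⟩
    0#                                  ∎
    where
      x : Carrier
      x = (∂ (proj₁ f) ⧢ proj₁ (f ^ᵍ k)) n

  ^ᵍ-cong : ∀ k {f g} → f ≈ᵍ g → (f ^ᵍ k) ≈ᵍ (g ^ᵍ k)
  ^ᵍ-cong zero    f≈g n = refl
  ^ᵍ-cong (suc k) f≈g n = ⧢-cong n f≈g (^ᵍ-cong k f≈g)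

  ⧢ᵍ-isAbelianGroup : ∀ k → (suc k · 1#) ≈ 0# → IsAbelianGroup _≈ᵍ_ _⧢ᵍ_ 𝟙 (λ f → f ^ᵍ k)
  ⧢ᵍ-isAbelianGroup k p·1≈0 = record
    { isGroup = record
      { isMonoid = record
        { isSemigroup = record
          { isMagma = record
            { isEquivalence = record
              { refl  = λ n → refl
              ; sym   = λ f≈g n → sym (f≈g n)
              ; trans = λ f≈g g≈h n → trans (f≈g n) (g≈h n)
              }
            ; ∙-cong = λ f≈f′ g≈g′ n → ⧢-cong n f≈f′ g≈g′
            }
          ; assoc = λ f g h n → ⧢-assoc n (proj₁ f) (proj₁ g) (proj₁ h)
          }
        ; identity = (λ f n → ⧢-identityˡ n (proj₁ f)) , (λ f n → ⧢-identityʳ n (proj₁ f))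
        }
      ; inverse = (λ f n → trans (⧢-comm n _ (proj₁ f)) (^ᵍ-characteristic k p·1≈0 f n))
                , ^ᵍ-characteristic k p·1≈0
      ; ⁻¹-cong = ^ᵍ-cong k
      }
    ; comm = λ f g n → ⧢-comm n (proj₁ f) (proj₁ g)
    }

  VanishesBelow : ℕ → Series → Set ℓ
  VanishesBelow d f = ∀ j → j < d → f j ≈ 0#

  ⧢-vanishesBelow : ∀ a b {f g} → VanishesBelow a f → VanishesBelow b g →
                    VanishesBelow (a ℕ.+ b) (f ⧢ g)
  ⧢-vanishesBelow a b {f} {g} f-low g-low n n<a+b = sumTo-zero n term≈0
    where
      factor≈0 : ∀ {k} → k < a ⊎ n ∸ k < b → f k * g (n ∸ k) ≈ 0#
      factor≈0 (inj₁ k<a)   = trans (*-congʳ (f-low _ k<a)) (zeroˡ _)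
      factor≈0 (inj₂ n∸k<b) = trans (*-congˡ (g-low _ n∸k<b)) (zeroʳ _)
      term≈0 : ∀ k → k ≤ n → (n C k) · (f k * g (n ∸ k)) ≈ 0#
      term≈0 k k≤n =
        trans (×-congʳ (n C k) (factor≈0 (<-+-split a b k≤n n<a+b))) (·-zeroʳ (n C k))

  nonConstantPart : Series → Series
  nonConstantPart f zero    = 0#
  nonConstantPart f (suc j) = f (suc j)

  𝟙ₛ-⊕-nonConstantPart : ∀ f → f 0 ≈ 1# → f ≈ₛ (𝟙ₛ ⊕ nonConstantPart f)
  𝟙ₛ-⊕-nonConstantPart f f0≈1 zero    = trans f0≈1 (sym (+-identityʳ 1#))
  𝟙ₛ-⊕-nonConstantPart f f0≈1 (suc j) = sym (+-identityˡ (f (suc j)))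

  ⧢-1+-expand : ∀ f g → f 0 ≈ 1# → g 0 ≈ 1# → ∀ j →
    (f ⧢ g) j ≈ g j + (nonConstantPart f j + (nonConstantPart f ⧢ nonConstantPart g) j)
  ⧢-1+-expand f g f0≈1 g0≈1 j = begin
    (f ⧢ g) j
      ≈⟨ ⧢-congʳ j g (𝟙ₛ-⊕-nonConstantPart f f0≈1) ⟩
    ((𝟙ₛ ⊕ f′) ⧢ g) j
      ≈⟨ ⧢-distribʳ j 𝟙ₛ f′ g ⟩
    (𝟙ₛ ⧢ g) j + (f′ ⧢ g) j
      ≈⟨ +-cong (⧢-identityˡ j g) (⧢-congˡ j f′ (𝟙ₛ-⊕-nonConstantPart g g0≈1)) ⟩
    g j + (f′ ⧢ (𝟙ₛ ⊕ g′)) j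
      ≈⟨ +-congˡ (⧢-distribˡ j f′ 𝟙ₛ g′) ⟩
    g j + ((f′ ⧢ 𝟙ₛ) j + (f′ ⧢ g′) j)
      ≈⟨ +-congˡ (+-congʳ (⧢-identityʳ j f′)) ⟩
    g j + (f′ j + (f′ ⧢ g′) j) ∎
    where
      f′ g′ : Series
      f′ = nonConstantPart f
      g′ = nonConstantPart g

  record StartsWith (d : ℕ) (c : Carrier) (h : Series) : Set ℓ where
    constructor startsWith
    field
      constant : h 0 ≈ 1#
      gap      : VanishesBelow d (nonConstantPart h)
      leading  : h d ≈ c

  startsWith-cong : ∀ d {c c′ h} → c ≈ c′ → StartsWith d c h → StartsWith d c′ h
  startsWith-cong d c≈c′ (startsWith h0≈1 h-gap h-top) = startsWith h0≈1 h-gap (trans h-top c≈c′)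

  startsWith-𝟙 : ∀ e → StartsWith (suc e) 0# 𝟙ₛ
  startsWith-𝟙 e = startsWith refl (λ { zero _ → refl ; (suc j) _ → refl }) refl

  startsWith-weaken : ∀ e {c h} → StartsWith (suc (suc e)) c h → StartsWith (suc e) 0# h
  startsWith-weaken e (startsWith h0≈1 h-gap _) =
    startsWith h0≈1 (λ j j<1+e → h-gap j (ℕₚ.m<n⇒m<1+n j<1+e)) (h-gap (suc e) (ℕₚ.n<1+n (suc e)))

  startsWith-⧢ : ∀ e {c c′ g h} → StartsWith (suc e) c g → StartsWith (suc e) c′ h →
                 StartsWith (suc e) (c + c′) (g ⧢ h)
  startsWith-⧢ e {c} {c′} {g} {h} (startsWith g0≈1 g-gap g-top) (startsWith h0≈1 h-gap h-top) =
    startsWith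
      (trans (⧢-head g h) (trans (*-cong g0≈1 h0≈1) (*-identityʳ 1#)))
      (λ { zero _ → refl
         ; (suc j) j<d → trans (coefficient (suc j) (ℕₚ.<⇒≤ j<d))
                           (trans (+-cong (g-gap (suc j) j<d) (h-gap (suc j) j<d)) (+-identityʳ 0#)) })
      (trans (coefficient (suc e) ℕₚ.≤-refl) (+-cong g-top h-top))
    where
      g′ h′ : Series
      g′ = nonConstantPart g
      h′ = nonConstantPart h
      cross≈0 : ∀ j → j ≤ suc e → (g′ ⧢ h′) j ≈ 0#
      cross≈0 j j≤d = ⧢-vanishesBelow (suc e) 1 {g′} {h′} g-gap
        (λ { zero _ → refl ; (suc _) (s≤s ()) }) j (ℕₚ.≤-<-trans j≤d (ℕₚ.m<m+n (suc e) (s≤s z≤n)))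
      coefficient : ∀ j → j ≤ suc e → (g ⧢ h) j ≈ g′ j + h j
      coefficient j j≤d = begin
        (g ⧢ h) j                   ≈⟨ ⧢-1+-expand g h g0≈1 h0≈1 j ⟩
        h j + (g′ j + (g′ ⧢ h′) j)  ≈⟨ +-congˡ (trans (+-congˡ (cross≈0 j j≤d)) (+-identityʳ _)) ⟩
        h j + g′ j                  ≈⟨ +-comm _ _ ⟩
        g′ j + h j                  ∎

  startsWith-^ᵍ : ∀ e {c} (v : Special) → StartsWith (suc e) c (proj₁ v) →
                  ∀ a → StartsWith (suc e) (a · c) (proj₁ (v ^ᵍ a))
  startsWith-^ᵍ e v v-start zero    = startsWith-𝟙 e
  startsWith-^ᵍ e v v-start (suc a) = startsWith-⧢ e v-start (startsWith-^ᵍ e v v-start a)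

  δ : ℕ → ℕ → Carrier
  δ zero    zero    = 1#
  δ zero    (suc _) = 0#
  δ (suc _) zero    = 0#
  δ (suc i) (suc j) = δ i j

  δ-refl : ∀ i → δ i i ≈ 1#
  δ-refl zero    = refl
  δ-refl (suc i) = δ-refl i

  δ-< : ∀ {i j} → i < j → δ i j ≈ 0#
  δ-< {zero}  {suc j} _         = refl
  δ-< {suc i} {suc j} (s≤s i<j) = δ-< i<j

  1+X^ : ℕ → Series
  1+X^ d zero    = 1#
  1+X^ d (suc j) = δ (suc j) d

  startsWith-1+X^ : ∀ e → StartsWith (suc e) 1# (1+X^ (suc e))
  startsWith-1+X^ e = startsWith refl (λ { zero _ → refl ; (suc j) j<e → δ-< j<e }) (δ-refl e)

  1+X^ᵍ : ℕ → Special
  1+X^ᵍ d = 1+X^ d , refl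

  basisFrom : ∀ {n} → ℕ → Fin n → Special
  basisFrom e Fin.zero    = 1+X^ᵍ (suc e)
  basisFrom e (Fin.suc i) = basisFrom (suc e) i

  linComb-startsWith : ∀ {n} e (a : Fin (suc n) → ℕ) →
    StartsWith (suc e) (a Fin.zero · 1#) (proj₁ (linComb a (basisFrom e)))
  linComb-tail-startsWith : ∀ {n} e (a : Fin n → ℕ) →
    StartsWith (suc e) 0# (proj₁ (linComb a (basisFrom (suc e))))

  linComb-startsWith e a = startsWith-cong (suc e) (+-identityʳ _)
    (startsWith-⧢ e (startsWith-^ᵍ e (1+X^ᵍ (suc e)) (startsWith-1+X^ e) (a Fin.zero))
                (linComb-tail-startsWith e (a ∘ Fin.suc)))

  linComb-tail-startsWith {zero}  e a = startsWith-𝟙 e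
  linComb-tail-startsWith {suc n} e a = startsWith-weaken e (linComb-startsWith (suc e) a)

  ^ᵍ-≡0 : ∀ {m} f → m ≡ 0 → (f ^ᵍ m) ≈ᵍ 𝟙
  ^ᵍ-≡0 f ≡.refl n = refl

  module _ (p : ℕ) (minimal : ∀ m → 0 < m → m < p → ¬ ((m · 1#) ≈ 0#)) where

    ·1#≈0⇒≡0 : ∀ {m} → m < p → (m · 1#) ≈ 0# → m ≡ 0
    ·1#≈0⇒≡0 {zero}  _   _       = ≡.refl
    ·1#≈0⇒≡0 {suc m} m<p m·1≈0 = ⊥-elim (minimal (suc m) (s≤s z≤n) m<p m·1≈0)

    basisFrom-linearlyIndependent : ∀ n e → LinearlyIndependent p {n} (basisFrom e)
    basisFrom-linearlyIndependent zero    e a _ ()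
    basisFrom-linearlyIndependent (suc n) e a comb≈𝟙 Fin.zero    = a₀≡0
      where
        a₀≡0 : toℕ (a Fin.zero) ≡ 0
        a₀≡0 = ·1#≈0⇒≡0 (toℕ<n (a Fin.zero))
          (trans (sym (StartsWith.leading (linComb-startsWith e (toℕ ∘ a)))) (comb≈𝟙 (suc e)))
    basisFrom-linearlyIndependent (suc n) e a comb≈𝟙 (Fin.suc i) =
      basisFrom-linearlyIndependent n (suc e) (a ∘ Fin.suc) rest≈𝟙 i
      where
        power≈𝟙 : (1+X^ᵍ (suc e) ^ᵍ toℕ (a Fin.zero)) ≈ᵍ 𝟙
        power≈𝟙 = ^ᵍ-≡0 (1+X^ᵍ (suc e))
          (basisFrom-linearlyIndependent (suc n) e a comb≈𝟙 Fin.zero)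
        rest : Special
        rest = linComb (toℕ ∘ a ∘ Fin.suc) (basisFrom (suc e))
        rest≈𝟙 : rest ≈ᵍ 𝟙
        rest≈𝟙 j = trans (sym (⧢-identityˡ j (proj₁ rest)))
                         (trans (⧢-congʳ j (proj₁ rest) (λ k → sym (power≈𝟙 k))) (comb≈𝟙 j))

proposition4p1 : ∀ {c ℓ : Level} (K : Field c ℓ) (p : ℕ) →
    FieldOps.HasCharacteristic K p →
    let open Shuffle K in
    (Σ (Special → Special) λ inv → IsAbelianGroup _≈ᵍ_ _⧢ᵍ_ 𝟙 inv)
    × (∀ f → (f ^ᵍ p) ≈ᵍ 𝟙)
    × (∀ n → ∃ λ (v : Fin n → Special) → LinearlyIndependent p v)
proposition4p1 K zero    (() , _)
proposition4p1 K (suc k) (_ , p·1≈0 , minimal) =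
    ((λ f → f ^ᵍ k) , ⧢ᵍ-isAbelianGroup k p·1≈0)
  , ^ᵍ-characteristic k p·1≈0
  , (λ n → basisFrom 0 , basisFrom-linearlyIndependent (suc k) minimal n 0)
  where
    open Shuffle K
    open ShuffleAlgebra K
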